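{- Let $m>0$, let $F=(X,R)$ be a cluster frame (i.e. $R^*=X\times X$) with $R^{m+1}\subseteq R\cup Id_X$, and let $V\subseteq X$. Then there exists $U\subseteq V$ with $|U|\le m+1$ and $R^{ -1}[V]=R^{ -1}[U]$.
   Context: $R^*=\bigcup_{i<\omega}R^i$ is the reflexive transitive closure; $Id_X$ is the diagonal; $R^{ -1}[V]=\{a\in X:\exists v\in V\ aRv\}$. -}

module Defs where

open import Data.Nat using (ℕ; zero; suc)
open import Data.Product using (Σ; ∃; _×_)
open import Data.Sum using (_⊎_)
open import Data.List using (List)
open import Data.List.Membership.Propositional using (_∈_)
open import Relation.Binary.PropositionalEquality using (_≡_)

Rel₀ : Set → Set₁
Rel₀ X = X → X → Set

Pow : {X : Set} → Rel₀ X → ℕ → Rel₀ X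
Pow R zero    x y = x ≡ y
Pow R (suc i) x y = ∃ λ z → Pow R i x z × R z y

RTClosure : {X : Set} → Rel₀ X → Rel₀ X
RTClosure R x y = ∃ λ i → Pow R i x y

IsCluster : {X : Set} → Rel₀ X → Set
IsCluster {X} R = (x y : X) → RTClosure R x y

PowBounded : {X : Set} → Rel₀ X → ℕ → Set
PowBounded {X} R m = (x y : X) → Pow R (suc m) x y → R x y ⊎ x ≡ y

Preimage : {X : Set} → Rel₀ X → (X → Set) → X → Set
Preimage R V a = ∃ λ v → V v × R a v

PreimageL : {X : Set} → Rel₀ X → List X → X → Set
PreimageL R U a = ∃ λ u → u ∈ U × R a u

{-# OPTIONS --safe #-}
module Submission where

-- Greedily choose points of V with witnesses, each witness seeing its own point but none of the
-- points chosen before; it suffices that such a staircase has at most m + 1 steps.  Given m + 2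
-- steps, the last witness a misses the m + 1 earlier points, and each of them has a level
-- s ≤ m, s ≠ 1 (a R^s x but not a R^(s+1) x), so two of them share a level.  Points of equal
-- level have the same R-predecessors, contradicting the staircase.  For this, either some point
-- lies on a closed walk of length m + 1, and then (by the cluster property) every point does and
-- equal levels force equal points; or R^(m+1) ⊆ R, so that R absorbs walks whose length is a
-- multiple of m, and two points at equal distance from a are joined by such a walk.

open import Defs
open import Axiom.ExcludedMiddle using (ExcludedMiddle)
open import Level using (0ℓ)
open import Data.Nat using (ℕ; suc; _<_; _≤_)
open import Data.Product using (Σ; _×_)
open import Data.List using (List; length)
open import Data.List.Relation.Unary.All using (All)
open import Function.Bundles using (_⇔_)

open import Axiom.DoubleNegationElimination using (em⇒dne)
open import Data.Empty using (⊥-elim)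
open import Data.Fin as Fin using (Fin; toℕ; punchOut) renaming (zero to fzero; suc to fsuc)
open import Data.Fin.Properties using (pigeonhole; punchOut-injective; toℕ≤n; toℕ-fromℕ<)
open import Data.List using (tabulate)
open import Data.List.Membership.Propositional.Properties using (∈-tabulate⁺; ∈-tabulate⁻)
open import Data.List.Properties using (length-tabulate)
open import Data.List.Relation.Unary.All.Properties using (tabulate⁺)
open import Data.Nat using (zero; _+_; _*_; _∸_; z≤n; s≤s)
open import Data.Nat.Properties
open import Data.Nat.Tactic.RingSolver using (solve-∀)
open import Data.Product using (_,_; ∃; ∃₂; proj₁; proj₂)
open import Data.Sum using (_⊎_; inj₁; inj₂; [_,_]′)
open import Data.Vec.Functional using (_∷_)
open import Function using (id; _∘_)
open import Function.Bundles using (mk⇔)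
open import Relation.Nullary using (¬_; yes; no)
open import Relation.Binary.PropositionalEquality using (_≡_; _≢_; refl; sym; subst)

last-before-failure : ExcludedMiddle 0ℓ → (Q : ℕ → Set) →
                      ∀ {i n} → i ≤ n → Q i → ¬ Q (suc n) →
                      ∃ λ s → s ≤ n × Q s × ¬ Q (suc s)
last-before-failure em Q {n = zero} z≤n qi ¬q₁ = 0 , z≤n , qi , ¬q₁
last-before-failure em Q {i} {suc n} i≤1+n qi ¬q₂₊ₙ with em {Q (suc n)}
... | yes q₁₊ₙ = suc n , ≤-refl , q₁₊ₙ , ¬q₂₊ₙ
... | no ¬q₁₊ₙ =
  let i≤n                 = ≤-pred (≤∧≢⇒< i≤1+n λ { refl → ¬q₁₊ₙ qi })
      s , s≤n , qs , ¬q₁₊ₛ = last-before-failure em Q i≤n qi ¬q₁₊ₙ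
  in s , m≤n⇒m≤1+n s≤n , qs , ¬q₁₊ₛ

module Walks {X : Set} (R : Rel₀ X) where

  Pow-cast : ∀ {i j x y} → i ≡ j → Pow R i x y → Pow R j x y
  Pow-cast refl p = p

  Pow-∷ : ∀ i {x y z} → R x y → Pow R i y z → Pow R (suc i) x z
  Pow-∷ zero    xRy refl          = _ , refl , xRy
  Pow-∷ (suc i) xRy (w , p , wRz) = w , Pow-∷ i xRy p , wRz

  Pow-trans : ∀ {i j x y z} → Pow R i x y → Pow R j y z → Pow R (j + i) x z
  Pow-trans {j = zero}  p refl          = p
  Pow-trans {j = suc j} p (w , q , wRz) = w , Pow-trans p q , wRz

  Pow-split : ∀ i j {x z} → Pow R (j + i) x z → ∃ λ y → Pow R i x y × Pow R j y z
  Pow-split i zero    p = _ , p , refl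
  Pow-split i (suc j) (w , p , wRz) =
    let y , x→y , y→w = Pow-split i j p in y , x→y , (w , y→w , wRz)

  Pow-loop : ∀ {x} → R x x → ∀ n → Pow R n x x
  Pow-loop xRx zero    = refl
  Pow-loop xRx (suc n) = _ , Pow-loop xRx n , xRx

  Pow-iterate : ∀ k {c x} → Pow R c x x → Pow R (k * c) x x
  Pow-iterate zero    p = refl
  Pow-iterate (suc k) p = Pow-trans (Pow-iterate k p) p

  absorb-Pow-multiple : ∀ {m} → (∀ u v → Pow R (suc m) u v → R u v) →
                        ∀ K {b x y} → R b x → Pow R (K * m) x y → R b y
  absorb-Pow-multiple         pow⊆R zero    bRx refl = bRx
  absorb-Pow-multiple {m = m} pow⊆R (suc K) bRx p =
    let w , x→w , w→y = Pow-split (K * m) m p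
    in pow⊆R _ _ (Pow-∷ m (absorb-Pow-multiple pow⊆R K bRx x→w) w→y)

  Pow⊆R⇒equidistant-same-predecessors :
    ∀ k → (∀ u v → Pow R (suc (suc k)) u v → R u v) → IsCluster R →
    ∀ {a s x y b} → Pow R s a x → Pow R s a y → R b x → R b y
  Pow⊆R⇒equidistant-same-predecessors k pow⊆R cluster {a} {s} {x} a→x a→y bRx =
    let γ , x→a = cluster x a
        x→y     = Pow-trans (Pow-iterate k (Pow-trans x→a a→x)) (Pow-trans x→a a→y)
    in absorb-Pow-multiple pow⊆R (s + γ) bRx (Pow-cast (*-comm (suc k) (s + γ)) x→y)

-- Index 0 is the step chosen last.
record Staircase {X : Set} (R : Rel₀ X) (V : X → Set) (n : ℕ) : Set where
  field
    point witness : Fin n → X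
    point∈V       : ∀ i → V (point i)
    sees          : ∀ i → R (witness i) (point i)
    ¬sees-above   : ∀ {i j} → toℕ i < toℕ j → ¬ R (witness i) (point j)

module Greedy {X : Set} (R : Rel₀ X) (V : X → Set) (em : ExcludedMiddle 0ℓ) where
  open Staircase

  Cover : ℕ → Set
  Cover N = Σ (List X) λ U → All V U × length U ≤ N ×
              ((a : X) → Preimage R V a ⇔ PreimageL R U a)

  Cover-weaken : ∀ {N N′} → N ≤ N′ → Cover N → Cover N′
  Cover-weaken N≤N′ (U , U⊆V , |U|≤N , same) = U , U⊆V , ≤-trans |U|≤N N≤N′ , same

  Uncovered : ∀ {n} → Staircase R V n → X → Set
  Uncovered st c = Preimage R V c × (∀ i → ¬ R c (point st i))

  empty : Staircase R V 0
  empty = record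
    { point = λ () ; witness = λ () ; point∈V = λ () ; sees = λ () ; ¬sees-above = λ {} }

  extend : ∀ {n c} → (st : Staircase R V n) → Uncovered st c → Staircase R V (suc n)
  extend {c = c} st ((v , v∈V , cRv) , blind) = record
    { point       = v ∷ point st
    ; witness     = c ∷ witness st
    ; point∈V     = λ { fzero → v∈V ; (fsuc i) → point∈V st i }
    ; sees        = λ { fzero → cRv ; (fsuc i) → sees st i }
    ; ¬sees-above = λ { {fzero} {fsuc j} _ → blind j
                      ; {fsuc i} {fsuc j} (s≤s i<j) → ¬sees-above st i<j
                      ; {_} {fzero} () }
    }

  points-cover : ∀ {n} → (st : Staircase R V n) → ¬ ∃ (Uncovered st) → Cover n
  points-cover st covered =
    tabulate (point st) , tabulate⁺ (point∈V st) , ≤-reflexive (length-tabulate (point st)) ,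
    λ a → mk⇔ (to a) (from a)
    where
    to : ∀ a → Preimage R V a → PreimageL R (tabulate (point st)) a
    to a a∈R⁻¹V =
      let i , aRpᵢ = em⇒dne em λ unseen → covered (a , a∈R⁻¹V , λ i aRpᵢ → unseen (i , aRpᵢ))
      in point st i , ∈-tabulate⁺ i , aRpᵢ
    from : ∀ a → PreimageL R (tabulate (point st)) a → Preimage R V a
    from a (u , u∈U , aRu) with ∈-tabulate⁻ u∈U
    ... | i , refl = point st i , point∈V st i , aRu

  cover-or-extend : ∀ {n} → Staircase R V n → Cover n ⊎ Staircase R V (suc n)
  cover-or-extend st with em {∃ (Uncovered st)}
  ... | yes (c , uncovered) = inj₂ (extend st uncovered)
  ... | no covered          = inj₁ (points-cover st covered)

  cover-or-staircase : ∀ N → Cover N ⊎ Staircase R V (suc N)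
  cover-or-staircase zero = cover-or-extend empty
  cover-or-staircase (suc N) with cover-or-staircase N
  ... | inj₁ cover = inj₁ (Cover-weaken (n≤1+n N) cover)
  ... | inj₂ st    = cover-or-extend st

loop-length : ∀ k i j →
              j + ((k * (i + j) + 1) * suc (suc k) + i) ≡ suc ((suc k * (i + j) + 1) * suc k)
loop-length = solve-∀

module BoundedPower {X : Set} {R : Rel₀ X} (k : ℕ) (bounded : PowBounded R (suc k)) where
  open Walks R

  m : ℕ
  m = suc k

  Pow-shorten : ∀ i {x y} → Pow R i x y → ∃ λ j → j ≤ m × Pow R j x y
  Pow-shorten zero    p = 0 , z≤n , p
  Pow-shorten (suc i) (z , p , zRy) with Pow-shorten i p
  ... | j , j≤m , q with m≤n⇒m<n∨m≡n j≤m
  ...   | inj₁ j<m = suc j , j<m , (z , q , zRy)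
  ...   | inj₂ refl with bounded _ _ (z , q , zRy)
  ...     | inj₁ xRy  = 1 , s≤s z≤n , (_ , refl , xRy)
  ...     | inj₂ refl = 0 , z≤n , refl

  closed-walk-shorten : ∀ K {z} → Pow R (suc (K * m)) z z → Pow R (suc m) z z
  closed-walk-shorten zero    (_ , refl , zRz) = Pow-loop zRz (suc m)
  closed-walk-shorten (suc K) {z} p with Pow-split (K * m) (suc m) p
  ... | q , z→q , q→z with bounded q z q→z
  ...   | inj₁ qRz  = closed-walk-shorten K (q , z→q , qRz)
  ...   | inj₂ refl = q→z

  -- Going t = k (i + j) + 1 times around the loop at w makes the length 1 + (m (i + j) + 1) m.
  closed-walk-spread : IsCluster R → ∀ {w} → Pow R (suc m) w w → ∀ z → Pow R (suc m) z z
  closed-walk-spread cluster {w} w→w z =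
    let i , z→w = cluster z w
        j , w→z = cluster w z
        t       = k * (i + j) + 1
    in closed-walk-shorten (m * (i + j) + 1)
         (Pow-cast (loop-length k i j) (Pow-trans (Pow-trans z→w (Pow-iterate t w→w)) w→z))

  Level : X → ℕ → X → Set
  Level a s x = Pow R s a x × ¬ Pow R (suc s) a x

  Level-injective : ∀ {a s x y} → Pow R (suc m) x x → s ≤ suc m →
                    Level a s x → Level a s y → x ≡ y
  Level-injective {a} {s} {x} {y} x→x s≤1+m (a→x , ¬a→ˢ⁺¹x) (a→y , ¬a→ˢ⁺¹y)
    with Pow-split (suc m ∸ s) s (Pow-cast (sym (m+[n∸m]≡n s≤1+m)) x→x)
  ... | z , x→z , z→x with bounded a z (Pow-cast (m∸n+n≡m s≤1+m) (Pow-trans a→x x→z))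
  ...   | inj₁ aRz  = ⊥-elim (¬a→ˢ⁺¹x (Pow-∷ s aRz z→x))
  ...   | inj₂ refl with bounded x y (Pow-cast (m+[n∸m]≡n s≤1+m) (Pow-trans x→z a→y))
  ...     | inj₁ xRy = ⊥-elim (¬a→ˢ⁺¹y (x , a→x , xRy))
  ...     | inj₂ x≡y = x≡y

  module _ (em : ExcludedMiddle 0ℓ) (cluster : IsCluster R) where

    loops-everywhere-or-Pow⊆R : (∀ z → Pow R (suc m) z z) ⊎ (∀ x y → Pow R (suc m) x y → R x y)
    loops-everywhere-or-Pow⊆R with em {∃ λ w → Pow R (suc m) w w}
    ... | yes (w , w→w) = inj₁ (closed-walk-spread cluster w→w)
    ... | no no-loop    = inj₂ λ x y x→y →
      [ id , (λ { refl → ⊥-elim (no-loop (x , x→y)) }) ]′ (bounded x y x→y)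

    Level⇒same-predecessors : ∀ {a s x y b} → s ≤ suc m →
                              Level a s x → Level a s y → R b x → R b y
    Level⇒same-predecessors {x = x} {b = b} s≤1+m ax ay bRx with loops-everywhere-or-Pow⊆R
    ... | inj₁ loops = subst (R b) (Level-injective (loops x) s≤1+m ax ay) bRx
    ... | inj₂ pow⊆R =
      Pow⊆R⇒equidistant-same-predecessors k pow⊆R cluster (proj₁ ax) (proj₁ ay) bRx

    Level-exists : ∀ {a x} → ¬ R a x → ∃ λ (s : Fin (suc m)) → Level a (toℕ s) x
    Level-exists {a} {x} ¬aRx with em {a ≡ x}
    ... | yes refl = fzero , refl , λ { (_ , refl , aRa) → ¬aRx aRa }
    ... | no a≢x =
      let i , a→x        = cluster a x
          j , j≤m , a→ʲx = Pow-shorten i a→x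
          s , s≤m , level = last-before-failure em (λ s → Pow R s a x) j≤m a→ʲx
                              ([ ¬aRx , a≢x ]′ ∘ bounded a x)
      in Fin.fromℕ< (s≤s s≤m) , subst (λ t → Level a t x) (sym (toℕ-fromℕ< (s≤s s≤m))) level

    pigeonhole-same-predecessors : ∀ {a} (x : Fin (suc m) → X) → (∀ j → ¬ R a (x j)) →
                                   ∃₂ λ p q → toℕ p < toℕ q × (∀ {b} → R b (x p) → R b (x q))
    pigeonhole-same-predecessors {a} x unseen =
      let p , q , p<q , same-code = pigeonhole (n<1+n m) code
          same-level              = punchOut-injective (1≢level p) (1≢level q) same-code
          level-q                 = subst (λ s → Level a (toℕ s) (x q)) (sym same-level)
                                          (proj₂ (level q))
      in p , q , p<q ,
         Level⇒same-predecessors (toℕ≤n (proj₁ (level p))) (proj₂ (level p)) level-q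
      where
      level : ∀ j → ∃ λ (s : Fin (suc m)) → Level a (toℕ s) (x j)
      level j = Level-exists (unseen j)

      1≢level : ∀ j → fsuc fzero ≢ proj₁ (level j)
      1≢level j 1≡s with level j
      1≢level j refl | _ , (_ , refl , aRx) , _ = unseen j aRx

      code : Fin (suc m) → Fin m
      code j = punchOut (1≢level j)

    no-staircase : ∀ {V} → ¬ Staircase R V (suc (suc m))
    no-staircase st =
      let p , q , p<q , p⊆q = pigeonhole-same-predecessors (point ∘ fsuc)
                                (λ j → ¬sees-above {fzero} {fsuc j} (s≤s z≤n))
      in ¬sees-above (s≤s p<q) (p⊆q (sees (fsuc p)))
      where open Staircase st

proposition28 : ExcludedMiddle 0ℓ →
    (m : ℕ) → 0 < m →
    (X : Set) (R : X → X → Set) →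
    IsCluster R → PowBounded R m →
    (V : X → Set) →
    Σ (List X) λ U → All V U × length U ≤ suc m ×
      ((a : X) → Preimage R V a ⇔ PreimageL R U a)
proposition28 em (suc k) _ X R cluster bounded V
  with Greedy.cover-or-staircase R V em (suc (suc k))
... | inj₁ cover = cover
... | inj₂ st    = ⊥-elim (BoundedPower.no-staircase k bounded em cluster st)
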